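{- Let $n\ge 2$. For every $\mathsf u\in\mathcal S_n$, the sequence of skip reflections $\mathsf r^{\mathsf u}$ is a tree-like factorization of $\lambda_n$.
   Context: $\widetilde S_n$ is the affine symmetric group (bijections $w:\mathbb Z\to\mathbb Z$ with $w(i+n)=w(i)+n$ and $\sum_{i=1}^n w(i)=\binom{n+1}{2}$, multiplied by composition $(vw)(k)=v(w(k))$). For $i\not\equiv j\pmod n$, $(\!(i,j)\!)$ interchanges $i+kn$ and $j+kn$ for all $k$ and fixes other integers; $s_j=(\!(j,j+1)\!)$. $\lambda_n(k)=k+n$ if $k\not\equiv0\pmod n$ and $\lambda_n(k)=k-n(n-1)$ if $k\equiv0\pmod n$; its reflection length is $2n-2$. A tree-like factorization of $\lambda_n$ is a sequence $[r_1,\dots,r_{2n-2}]$ of affine reflections with $r_1\cdots r_{2n-2}=\lambda_n$ for which there exist integers $a_0,\dots,a_{2n-3},b_1,\dots,b_{2n-2}$ with $r_k=(\!(a_{k-1},b_k)\!)$, $a_{k-1}<b_k$ ($1\le k\le 2n-2$) and $a_k\equiv b_k\pmod n$ ($1\le k\le 2n-3$). $\boldsymbol\lambda_n$ is the word $[s_0,\dots,s_{n-1}]$ repeated $n-1$ times; its $j$-th letter ($1\le j\le n(n-1)$) is $s_{j-1}$. A subword is $\mathsf u=[u_1,\dots,u_{n(n-1)}]$ with each $u_j$ either the $j$-th letter (a take) or $e$ (a skip); $u_{(j)}=u_1\cdots u_j$, $u_{(0)}=e$. $\mathcal S_n$ is the set of subwords with exactly $2n-2$ skips and $u_{(n(n-1))}=e$.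 For $1\le j\le n(n-1)$ let $t_j=u_{(j-1)}s_{j-1}u_{(j-1)}^{ -1}$; the skip reflections $\mathsf r^{\mathsf u}$ are the $t_j$ over skip indices $j$, listed in increasing order of $j$. -}

module Defs where

open import Data.Nat as ℕ using (ℕ; zero; suc)
open import Data.Nat.Divisibility as ℕD using ()
open import Data.Integer as ℤ using (ℤ; +_; ∣_∣)
open import Data.Bool using (Bool; true; false; if_then_else_)
open import Data.List using (List; []; _∷_; _++_; [_]; length; lookup; foldr; reverse; map; concat; replicate; upTo; zip; filter)
open import Data.Fin using (Fin; toℕ)
open import Data.Product using (Σ; _×_; _,_; ∃)
open import Relation.Nullary using (¬_; does)
open import Relation.Binary.PropositionalEquality using (_≡_)
open import Function using (_∘_; id)

_≡[mod_]_ : ℤ → ℕ → ℤ → Set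
a ≡[mod n ] b = n ℕD.∣ ∣ a ℤ.- b ∣

cong? : ℕ → ℤ → ℤ → Bool
cong? n a b = does (n ℕD.∣? ∣ a ℤ.- b ∣)

-- affine maps represented as functions ℤ → ℤ; product (vw)(k) = v (w k)
Aff : Set
Aff = ℤ → ℤ

_≈_ : Aff → Aff → Set
f ≈ g = ∀ k → f k ≡ g k

e : Aff
e = id

prod : List Aff → Aff
prod = foldr (λ f g → f ∘ g) id

-- the affine reflection ((i , j)) in S̃ₙ (meaningful when i ≢ j mod n):
-- i + kn ↦ j + kn, j + kn ↦ i + kn, other integers fixed
refl⟨_⟩ : ℕ → ℤ → ℤ → Aff
refl⟨ n ⟩ i j k =
  if cong? n k i then k ℤ.- i ℤ.+ j
  else if cong? n k j then k ℤ.- j ℤ.+ i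
  else k

sᵢ : ℕ → ℕ → Aff
sᵢ n i = refl⟨ n ⟩ (+ i) (+ suc i)

λ⟨_⟩ : ℕ → Aff
λ⟨ n ⟩ k = if cong? n k (+ 0) then k ℤ.- + (n ℕ.* (n ℕ.∸ 1)) else k ℤ.+ + n

-- the word 𝛌ₙ : [s₀,…,s_{n-1}] repeated n-1 times, recorded by the indices of the letters
word : ℕ → List ℕ
word n = concat (replicate (n ℕ.∸ 1) (upTo n))

-- a subword: one Bool per letter of 𝛌ₙ; true = take (uⱼ is the letter), false = skip (uⱼ = e)
Subword : Set
Subword = List Bool

letter : ℕ → ℕ × Bool → Aff
letter n (i , true)  = sᵢ n i
letter n (i , false) = e

uProd : ℕ → Subword → Aff
uProd n u = prod (map (letter n) (zip (word n) u))

countSkips : Subword → ℕ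
countSkips [] = 0
countSkips (true ∷ u) = countSkips u
countSkips (false ∷ u) = suc (countSkips u)

In𝒮 : ℕ → Subword → Set
In𝒮 n u = (length u ≡ n ℕ.* (n ℕ.∸ 1)) × (countSkips u ≡ 2 ℕ.* n ℕ.∸ 2) × (uProd n u ≈ e)

-- skip reflections.  `pre` is the list of taken simple-reflection indices so far,
-- so u_(j-1) = prod (map sᵢ pre) and u_(j-1)⁻¹ = prod (map sᵢ (reverse pre))
-- (each sᵢ is an involution).
skipReflsFrom : ℕ → List ℕ → List (ℕ × Bool) → List Aff
skipReflsFrom n pre [] = []
skipReflsFrom n pre ((i , true) ∷ rest) = skipReflsFrom n (pre ++ [ i ]) rest
skipReflsFrom n pre ((i , false) ∷ rest) =
  (prod (map (sᵢ n) pre) ∘ sᵢ n i ∘ prod (map (sᵢ n) (reverse pre)))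
  ∷ skipReflsFrom n pre rest

skipRefls : ℕ → Subword → List Aff
skipRefls n u = skipReflsFrom n [] (zip (word n) u)

-- tree-like factorization of w ∈ S̃ₙ with 2n-2 factors:
-- r = [r₁,…,r_{2n-2}] with r₁⋯r_{2n-2} = w, and integers a₀…a_{2n-3}, b₁…b_{2n-2}
-- with r_k = ((a_{k-1}, b_k)) an affine reflection (a_{k-1} ≢ b_k mod n),
-- a_{k-1} < b_k, and a_k ≡ b_k mod n for 1 ≤ k ≤ 2n-3.
-- (position p : Fin (length r), 0-based, corresponds to k = p+1)
TreeLike : ℕ → Aff → List Aff → Set
TreeLike n w r =
  (length r ≡ 2 ℕ.* n ℕ.∸ 2) × (prod r ≈ w) ×
  Σ (ℕ → ℤ) λ a → Σ (ℕ → ℤ) λ b →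
    (∀ (p : Fin (length r)) →
        (lookup r p ≈ refl⟨ n ⟩ (a (toℕ p)) (b (suc (toℕ p))))
      × ¬ (a (toℕ p) ≡[mod n ] b (suc (toℕ p)))
      × (a (toℕ p) ℤ.< b (suc (toℕ p))))
  × (∀ k → 1 ℕ.≤ k → k ℕ.≤ 2 ℕ.* n ℕ.∸ 3 → a k ≡[mod n ] b k)

-- Write u_(p) for the product of the first p letters of u; position p of 𝛌ₙ carries s_(p mod n).
-- At a skipped position p the skip reflection u_(p) s u_(p)⁻¹ is ((a_p, b_p)) with
-- a_p = u_(p)(p) and b_p = u_(p)(p + 1).  Since a_(p+1) = b_p after a skip and a_(p+1) = a_p
-- after a take, consecutive skip reflections share an endpoint exactly, and multiplying them
-- into u = e gives back the whole word 𝛌ₙ, whose product is λₙ.  What remains is a_p < b_p.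
-- With M = n - 1 and z_P = u_(P+1-M)(P - M) one has b_p = z_p + n, and z_(p+M) is b_p or a_p
-- according as p is taken or skipped.  A forward induction from u_(0) = e and a backward one
-- from u_(nM) = e squeeze z_P between Ψ(P) - n and Ψ(P), where Ψ(P) = P + ⌊P/M⌋ - M is z for
-- the full word; hence b_p - a_p ≤ M at every skip (b_p = a_p + n is excluded by a_p ≢ b_p).
-- Along each of the M residue classes of positions mod M the gaps b_p - a_p at skips
-- telescope to n > M, so every class holds at least two of the 2M skips, hence exactly two,
-- and a skip with a nonpositive gap would leave its class a sum of at most M.

module Submission where

open import Defs
open import Data.Nat using (ℕ; _≤_)

open import Data.Nat as ℕ using (zero; suc; z≤n; s≤s; _<_)
import Data.Nat.Properties as ℕP
import Data.Nat.Divisibility as ℕD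
import Data.Nat.DivMod as ℕDM
import Data.Integer.DivMod as ℤDM
open import Data.Integer as ℤ using (ℤ; +_; -[1+_]; ∣_∣; _+_; _*_; _-_; -_; 0ℤ; 1ℤ)
import Data.Integer.Properties as ℤP
open import Data.Integer.Tactic.RingSolver using (solve-∀)
open import Data.Bool using (Bool; true; false; if_then_else_)
open import Data.List using (List; []; _∷_; _++_; [_]; length; map; concat; replicate; upTo; zip; applyUpTo; lookup; reverse)
open import Data.List.Properties using (length-upTo; length-++; map-++; reverse-++)
open import Data.Fin as Fin using (Fin; toℕ)
open import Data.Product using (∃; _×_; _,_; proj₁; proj₂)
open import Data.Sum using (inj₁; inj₂)
open import Data.Empty using (⊥-elim)
open import Data.Unit using (⊤; tt)
open import Relation.Nullary using (¬_; Dec; yes; no)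
open import Relation.Nullary.Decidable using (dec-true; dec-false; map′)
open import Relation.Binary.PropositionalEquality using (_≡_; _≢_; refl; sym; trans; cong; cong₂; subst; subst₂; module ≡-Reasoning)
open import Function using (_∘_; id)
open import Algebra.Properties.CommutativeSemigroup ℤP.+-commutativeSemigroup using (interchange)
open import Algebra.Properties.AbelianGroup ℤP.+-0-abelianGroup using () renaming (∙-cancelˡ to +-cancelˡ-≡)

+-cancelʳ-≤ : ∀ {a b} c → a + c ℤ.≤ b + c → a ℤ.≤ b
+-cancelʳ-≤ {a} {b} c h = subst₂ ℤ._≤_ (a+c-c a c) (a+c-c b c) (ℤP.+-monoˡ-≤ (- c) h)
  where
  a+c-c : ∀ a c → a + c + - c ≡ a
  a+c-c = solve-∀

i+j≡k+l⇒l≡i-k+j : ∀ i j k l → i + j ≡ k + l → l ≡ i - k + j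
i+j≡k+l⇒l≡i-k+j i j k l h = begin
  l             ≡⟨ cancel k l ⟨
  k + l - k     ≡⟨ cong (_- k) h ⟨
  i + j - k     ≡⟨ swap i j k ⟩
  i - k + j     ∎
  where
  open ≡-Reasoning
  cancel : ∀ k l → k + l - k ≡ l
  cancel = solve-∀
  swap : ∀ i j k → i + j - k ≡ i - k + j
  swap = solve-∀

sumℤ : ℕ → (ℕ → ℤ) → ℤ
sumℤ zero    f = 0ℤ
sumℤ (suc k) f = sumℤ k f + f k

module _ where
  open ≡-Reasoning

  sumℤ-zero : ∀ k → sumℤ k (λ _ → 0ℤ) ≡ 0ℤ
  sumℤ-zero zero    = refl
  sumℤ-zero (suc k) = trans (ℤP.+-identityʳ _) (sumℤ-zero k)

  sumℤ-const : ∀ k a → sumℤ k (λ _ → a) ≡ + k * a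
  sumℤ-const zero    a = sym (ℤP.*-zeroˡ a)
  sumℤ-const (suc k) a = begin
    sumℤ k (λ _ → a) + a ≡⟨ cong (_+ a) (sumℤ-const k a) ⟩
    + k * a + a          ≡⟨ k*a+a (+ k) a ⟩
    + suc k * a          ∎
    where
    k*a+a : ∀ k a → k * a + a ≡ (1ℤ + k) * a
    k*a+a = solve-∀

  sumℤ-+ : ∀ k f g → sumℤ k (λ i → f i + g i) ≡ sumℤ k f + sumℤ k g
  sumℤ-+ zero    f g = refl
  sumℤ-+ (suc k) f g = begin
    sumℤ k (λ i → f i + g i) + (f k + g k) ≡⟨ cong (_+ (f k + g k)) (sumℤ-+ k f g) ⟩
    sumℤ k f + sumℤ k g + (f k + g k)      ≡⟨ interchange (sumℤ k f) (sumℤ k g) (f k) (g k) ⟩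
    sumℤ k f + f k + (sumℤ k g + g k)      ∎

  sumℤ-*ˡ : ∀ k a f → sumℤ k (λ i → a * f i) ≡ a * sumℤ k f
  sumℤ-*ˡ zero    a f = sym (ℤP.*-zeroʳ a)
  sumℤ-*ˡ (suc k) a f = trans (cong (_+ a * f k) (sumℤ-*ˡ k a f)) (sym (ℤP.*-distribˡ-+ a (sumℤ k f) (f k)))

  sumℤ-split : ∀ a b f → sumℤ (a ℕ.+ b) f ≡ sumℤ a f + sumℤ b (λ i → f (a ℕ.+ i))
  sumℤ-split a zero    f = trans (cong (λ k → sumℤ k f) (ℕP.+-identityʳ a)) (sym (ℤP.+-identityʳ (sumℤ a f)))
  sumℤ-split a (suc b) f = begin
    sumℤ (a ℕ.+ suc b) f                                   ≡⟨ cong (λ k → sumℤ k f) (ℕP.+-suc a b) ⟩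
    sumℤ (a ℕ.+ b) f + f (a ℕ.+ b)                          ≡⟨ cong (_+ f (a ℕ.+ b)) (sumℤ-split a b f) ⟩
    sumℤ a f + sumℤ b (λ i → f (a ℕ.+ i)) + f (a ℕ.+ b)     ≡⟨ ℤP.+-assoc (sumℤ a f) _ _ ⟩
    sumℤ a f + sumℤ (suc b) (λ i → f (a ℕ.+ i))             ∎

  sumℤ-blocks : ∀ K B f → sumℤ (K ℕ.* B) f ≡ sumℤ K (λ j → sumℤ B (λ s → f (j ℕ.* B ℕ.+ s)))
  sumℤ-blocks zero    B f = refl
  sumℤ-blocks (suc K) B f = begin
    sumℤ (B ℕ.+ K ℕ.* B) f                                     ≡⟨ cong (λ k → sumℤ k f) (ℕP.+-comm B (K ℕ.* B)) ⟩
    sumℤ (K ℕ.* B ℕ.+ B) f                                     ≡⟨ sumℤ-split (K ℕ.* B) B f ⟩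
    sumℤ (K ℕ.* B) f + sumℤ B (λ s → f (K ℕ.* B ℕ.+ s))
      ≡⟨ cong (_+ sumℤ B (λ s → f (K ℕ.* B ℕ.+ s))) (sumℤ-blocks K B f) ⟩
    sumℤ (suc K) (λ j → sumℤ B (λ s → f (j ℕ.* B ℕ.+ s)))       ∎

  sumℤ-swap : ∀ a b (h : ℕ → ℕ → ℤ) → sumℤ a (λ j → sumℤ b (h j)) ≡ sumℤ b (λ s → sumℤ a (λ j → h j s))
  sumℤ-swap zero    b h = sym (sumℤ-zero b)
  sumℤ-swap (suc a) b h = begin
    sumℤ a (λ j → sumℤ b (h j)) + sumℤ b (h a)                 ≡⟨ cong (_+ sumℤ b (h a)) (sumℤ-swap a b h) ⟩
    sumℤ b (λ s → sumℤ a (λ j → h j s)) + sumℤ b (h a)         ≡⟨ sumℤ-+ b (λ s → sumℤ a (λ j → h j s)) (h a) ⟨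
    sumℤ b (λ s → sumℤ (suc a) (λ j → h j s))                  ∎

sumℤ-mono-≤ : ∀ k {f g} → (∀ i → i < k → f i ℤ.≤ g i) → sumℤ k f ℤ.≤ sumℤ k g
sumℤ-mono-≤ zero    f≤g = ℤP.≤-refl
sumℤ-mono-≤ (suc k) f≤g = ℤP.+-mono-≤ (sumℤ-mono-≤ k (λ i i<k → f≤g i (ℕP.m<n⇒m<1+n i<k))) (f≤g k ℕP.≤-refl)

sumℤ-mono-≤-gap : ∀ k {f g j} d → (∀ i → i < k → f i ℤ.≤ g i) → j < k → f j + d ℤ.≤ g j →
                  sumℤ k f + d ℤ.≤ sumℤ k g
sumℤ-mono-≤-gap (suc k) {f} {g} {j} d f≤g j<1+k gap with ℕP.m<1+n⇒m<n∨m≡n j<1+k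
... | inj₁ j<k = subst (ℤ._≤ sumℤ (suc k) g) (swap (sumℤ k f) d (f k))
                   (ℤP.+-mono-≤ (sumℤ-mono-≤-gap k d (λ i i<k → f≤g i (ℕP.m<n⇒m<1+n i<k)) j<k gap) (f≤g k ℕP.≤-refl))
  where
  swap : ∀ a b c → a + b + c ≡ a + c + b
  swap = solve-∀
... | inj₂ refl = subst (ℤ._≤ sumℤ (suc k) g) (sym (ℤP.+-assoc (sumℤ k f) (f k) d))
                    (ℤP.+-mono-≤ (sumℤ-mono-≤ k (λ i i<k → f≤g i (ℕP.m<n⇒m<1+n i<k))) gap)

module Modular (n : ℕ) where

  infix 4 _∼_
  record _∼_ (a b : ℤ) : Set where
    constructor by
    field
      quotient : ℤ
      equation : a ≡ b + quotient * + n

  ∼-refl : ∀ a → a ∼ a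
  ∼-refl a = by 0ℤ (sym (trans (cong (_+_ a) (ℤP.*-zeroˡ (+ n))) (ℤP.+-identityʳ a)))

  ∼-sym : ∀ {a b} → a ∼ b → b ∼ a
  ∼-sym {a} {b} (by t a≡b+tn) = by (- t) (sym (trans (cong (_+ - t * + n) a≡b+tn) (cancel b t (+ n))))
    where
    cancel : ∀ b t n → b + t * n + - t * n ≡ b
    cancel = solve-∀

  +*n-+*n : ∀ a s t → a + s * + n + t * + n ≡ a + (s + t) * + n
  +*n-+*n a s t = collect a s t (+ n)
    where
    collect : ∀ a s t n → a + s * n + t * n ≡ a + (s + t) * n
    collect = solve-∀

  ∼-trans : ∀ {a b c} → a ∼ b → b ∼ c → a ∼ c
  ∼-trans {c = c} (by t a≡b+tn) (by s b≡c+sn) =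
    by (s + t) (trans a≡b+tn (trans (cong (_+ t * + n) b≡c+sn) (+*n-+*n c s t)))

  +*n∼ : ∀ a t → a + t * + n ∼ a
  +*n∼ a t = by t refl

  ∼-+*nˡ : ∀ {a b} t → a + t * + n ∼ b → a ∼ b
  ∼-+*nˡ {a} t = ∼-trans (∼-sym (+*n∼ a t))

  ∼-+*nʳ : ∀ {a b} t → a ∼ b + t * + n → a ∼ b
  ∼-+*nʳ {b = b} t a∼b+tn = ∼-trans a∼b+tn (+*n∼ b t)

  ∼⇒≡[mod] : ∀ {a b} → a ∼ b → a ≡[mod n ] b
  ∼⇒≡[mod] {a} {b} (by t a≡b+tn) = ℕD.divides ∣ t ∣ (begin
    ∣ a - b ∣       ≡⟨ cong (λ x → ∣ x - b ∣) a≡b+tn ⟩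
    ∣ b + t * + n - b ∣ ≡⟨ cong ∣_∣ (b+x-b b (t * + n)) ⟩
    ∣ t * + n ∣     ≡⟨ ℤP.abs-* t (+ n) ⟩
    ∣ t ∣ ℕ.* n     ∎)
    where
    open ≡-Reasoning
    b+x-b : ∀ b x → b + x - b ≡ x
    b+x-b = solve-∀

  private
    b+[a-b] : ∀ a b → a ≡ b + (a - b)
    b+[a-b] = solve-∀

  ≡[mod]⇒∼ : ∀ {a b} → a ≡[mod n ] b → a ∼ b
  ≡[mod]⇒∼ {a} {b} (ℕD.divides q ∣a-b∣≡qn) with a - b in a-b≡d
  ... | + d     = by (+ q) (trans (b+[a-b] a b) (cong (_+_ b) (trans a-b≡d (trans (cong +_ ∣a-b∣≡qn) (ℤP.pos-* q n)))))
  ... | -[1+ d ] = by (- + q) (trans (b+[a-b] a b) (cong (_+_ b) (trans a-b≡d (trans (cong (λ x → - + x) ∣a-b∣≡qn)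
                     (trans (cong -_ (ℤP.pos-* q n)) (ℤP.neg-distribˡ-* (+ q) (+ n)))))))

  _∼?_ : ∀ a b → Dec (a ∼ b)
  a ∼? b = map′ ≡[mod]⇒∼ ∼⇒≡[mod] (n ℕD.∣? ∣ a - b ∣)

  if-∼ : ∀ {a b} {x y : ℤ} → a ∼ b → (if cong? n a b then x else y) ≡ x
  if-∼ {a} {b} a∼b rewrite dec-true (n ℕD.∣? ∣ a - b ∣) (∼⇒≡[mod] a∼b) = refl

  if-≁ : ∀ {a b} {x y : ℤ} → ¬ a ∼ b → (if cong? n a b then x else y) ≡ y
  if-≁ {a} {b} a≁b rewrite dec-false (n ℕD.∣? ∣ a - b ∣) (a≁b ∘ ≡[mod]⇒∼) = refl

  ≁+small : ∀ a {d} → 0 < d → d < n → ¬ a ∼ a + + d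
  ≁+small a {d} 0<d d<n (by t a≡a+d+tn) = small ∣ t ∣ (begin
    d             ≡⟨⟩
    ∣ + d ∣       ≡⟨ cong ∣_∣ (+-cancelˡ-≡ a (+ d) (- t * + n) a+d≡a-tn) ⟩
    ∣ - t * + n ∣ ≡⟨ ℤP.abs-* (- t) (+ n) ⟩
    ∣ - t ∣ ℕ.* n ≡⟨ cong (ℕ._* n) (ℤP.∣-i∣≡∣i∣ t) ⟩
    ∣ t ∣ ℕ.* n   ∎)
    where
    open ≡-Reasoning
    cancel : ∀ a d t n → a + d + t * n + - t * n ≡ a + d
    cancel = solve-∀
    a+d≡a-tn : a + + d ≡ a + - t * + n
    a+d≡a-tn = trans (sym (cancel a (+ d) t (+ n))) (cong (_+ - t * + n) (sym a≡a+d+tn))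
    small : ∀ q → d ≢ q ℕ.* n
    small zero    d≡0   = ℕP.<⇒≢ 0<d (sym d≡0)
    small (suc q) d≡qn = ℕP.<⇒≱ d<n (subst (n ℕ.≤_) (sym d≡qn) (ℕP.m≤m+n n (q ℕ.* n)))

module Reflection (n : ℕ) where
  open Modular n

  Periodic : Aff → Set
  Periodic v = ∀ k t → v (k + t * + n) ≡ v k + t * + n

  refl⟨⟩-∼i : ∀ {i j k} → k ∼ i → refl⟨ n ⟩ i j k ≡ k - i + j
  refl⟨⟩-∼i k∼i = if-∼ k∼i

  refl⟨⟩-∼j : ∀ {i j k} → ¬ k ∼ i → k ∼ j → refl⟨ n ⟩ i j k ≡ k - j + i
  refl⟨⟩-∼j k≁i k∼j = trans (if-≁ k≁i) (if-∼ k∼j)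

  refl⟨⟩-fix : ∀ {i j k} → ¬ k ∼ i → ¬ k ∼ j → refl⟨ n ⟩ i j k ≡ k
  refl⟨⟩-fix k≁i k≁j = trans (if-≁ k≁i) (if-≁ k≁j)

  private
    move : ∀ i j x → i + x - i + j ≡ j + x
    move = solve-∀

    cancel : ∀ k i j x → k - (i + x) + (j + x) ≡ k - i + j
    cancel = solve-∀

  refl⟨⟩-i : ∀ i j t → refl⟨ n ⟩ i j (i + t * + n) ≡ j + t * + n
  refl⟨⟩-i i j t = trans (refl⟨⟩-∼i (+*n∼ i t)) (move i j (t * + n))

  refl⟨⟩-j : ∀ i j t → ¬ i ∼ j → refl⟨ n ⟩ i j (j + t * + n) ≡ i + t * + n
  refl⟨⟩-j i j t i≁j = trans (refl⟨⟩-∼j j+tn≁i (+*n∼ j t)) (move j i (t * + n))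
    where
    j+tn≁i : ¬ j + t * + n ∼ i
    j+tn≁i j+tn∼i = i≁j (∼-sym (∼-+*nˡ t j+tn∼i))

  refl⟨⟩-involutive : ∀ {i j} → ¬ i ∼ j → ∀ k → refl⟨ n ⟩ i j (refl⟨ n ⟩ i j k) ≡ k
  refl⟨⟩-involutive {i} {j} i≁j k with k ∼? i
  ... | yes (by t refl) = trans (cong (refl⟨ n ⟩ i j) (refl⟨⟩-i i j t)) (refl⟨⟩-j i j t i≁j)
  ... | no k≁i with k ∼? j
  ...   | yes (by t refl) = trans (cong (refl⟨ n ⟩ i j) (refl⟨⟩-j i j t i≁j)) (refl⟨⟩-i i j t)
  ...   | no k≁j = trans (cong (refl⟨ n ⟩ i j) (refl⟨⟩-fix k≁i k≁j)) (refl⟨⟩-fix k≁i k≁j)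

  refl⟨⟩-periodic : ∀ {i j} → ¬ i ∼ j → Periodic (refl⟨ n ⟩ i j)
  refl⟨⟩-periodic {i} {j} i≁j k t with k ∼? i
  ... | yes (by s refl) = begin
    refl⟨ n ⟩ i j (i + s * + n + t * + n) ≡⟨ cong (refl⟨ n ⟩ i j) (+*n-+*n i s t) ⟩
    refl⟨ n ⟩ i j (i + (s + t) * + n)     ≡⟨ refl⟨⟩-i i j (s + t) ⟩
    j + (s + t) * + n                     ≡⟨ +*n-+*n j s t ⟨
    j + s * + n + t * + n                 ≡⟨ cong (_+ t * + n) (refl⟨⟩-i i j s) ⟨
    refl⟨ n ⟩ i j (i + s * + n) + t * + n ∎
    where open ≡-Reasoning
  ... | no k≁i with k ∼? j
  ...   | yes (by s refl) = begin
    refl⟨ n ⟩ i j (j + s * + n + t * + n) ≡⟨ cong (refl⟨ n ⟩ i j) (+*n-+*n j s t) ⟩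
    refl⟨ n ⟩ i j (j + (s + t) * + n)     ≡⟨ refl⟨⟩-j i j (s + t) i≁j ⟩
    i + (s + t) * + n                     ≡⟨ +*n-+*n i s t ⟨
    i + s * + n + t * + n                 ≡⟨ cong (_+ t * + n) (refl⟨⟩-j i j s i≁j) ⟨
    refl⟨ n ⟩ i j (j + s * + n) + t * + n ∎
    where open ≡-Reasoning
  ...   | no k≁j = trans (refl⟨⟩-fix (k≁i ∘ ∼-+*nˡ t) (k≁j ∘ ∼-+*nˡ t)) (cong (_+ t * + n) (sym (refl⟨⟩-fix k≁i k≁j)))

  refl⟨⟩-translate : ∀ i j t k → refl⟨ n ⟩ (i + t * + n) (j + t * + n) k ≡ refl⟨ n ⟩ i j k
  refl⟨⟩-translate i j t k with k ∼? i
  ... | yes k∼i = trans (refl⟨⟩-∼i (∼-trans k∼i (∼-sym (+*n∼ i t))))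
                        (trans (cancel k i j (t * + n)) (sym (refl⟨⟩-∼i k∼i)))
  ... | no k≁i with k ∼? j
  ...   | yes k∼j = trans (refl⟨⟩-∼j (k≁i ∘ ∼-+*nʳ t) (∼-trans k∼j (∼-sym (+*n∼ j t))))
                          (trans (cancel k j i (t * + n)) (sym (refl⟨⟩-∼j k≁i k∼j)))
  ...   | no k≁j = trans (refl⟨⟩-fix (k≁i ∘ ∼-+*nʳ t) (k≁j ∘ ∼-+*nʳ t)) (sym (refl⟨⟩-fix k≁i k≁j))

  periodic-ext : .{{_ : ℕ.NonZero n}} → ∀ f g → Periodic f → Periodic g → ∀ x₀ →
                 (∀ r → r < n → f (x₀ + + r) ≡ g (x₀ + + r)) → ∀ k → f k ≡ g k
  periodic-ext f g per-f per-g x₀ agree k = begin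
    f k                     ≡⟨ cong f k≡ ⟩
    f (x₀ + + r + t * + n)  ≡⟨ per-f (x₀ + + r) t ⟩
    f (x₀ + + r) + t * + n  ≡⟨ cong (_+ t * + n) (agree r (ℤDM.n%d<d (k - x₀) (+ n))) ⟩
    g (x₀ + + r) + t * + n  ≡⟨ per-g (x₀ + + r) t ⟨
    g (x₀ + + r + t * + n)  ≡⟨ cong g k≡ ⟨
    g k                     ∎
    where
    open ≡-Reasoning
    r = (k - x₀) ℤDM.% + n
    t = (k - x₀) ℤDM./ + n
    k≡ : k ≡ x₀ + + r + t * + n
    k≡ = trans (sym (x₀+[k-x₀] x₀ k))
               (trans (cong (_+_ x₀) (ℤDM.a≡a%n+[a/n]*n (k - x₀) (+ n))) (sym (ℤP.+-assoc x₀ (+ r) (t * + n))))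
      where
      x₀+[k-x₀] : ∀ x₀ k → x₀ + (k - x₀) ≡ k
      x₀+[k-x₀] = solve-∀

  module _ {v w : Aff} (per : Periodic v) (wv : ∀ k → w (v k) ≡ k) where

    ∼-reflect : ∀ {a b} → v a ∼ v b → a ∼ b
    ∼-reflect {a} {b} (by t va≡vb+tn) = by t (begin
      a                 ≡⟨ wv a ⟨
      w (v a)           ≡⟨ cong w (trans va≡vb+tn (sym (per b t))) ⟩
      w (v (b + t * + n)) ≡⟨ wv (b + t * + n) ⟩
      b + t * + n       ∎)
      where open ≡-Reasoning

    refl⟨⟩-conjugate : ∀ {i j} → ¬ i ∼ j → ∀ x → v (refl⟨ n ⟩ i j x) ≡ refl⟨ n ⟩ (v i) (v j) (v x)
    refl⟨⟩-conjugate {i} {j} i≁j x with x ∼? i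
    ... | yes (by t refl) = begin
      v (refl⟨ n ⟩ i j (i + t * + n))       ≡⟨ cong v (refl⟨⟩-i i j t) ⟩
      v (j + t * + n)                       ≡⟨ per j t ⟩
      v j + t * + n                         ≡⟨ refl⟨⟩-i (v i) (v j) t ⟨
      refl⟨ n ⟩ (v i) (v j) (v i + t * + n) ≡⟨ cong (refl⟨ n ⟩ (v i) (v j)) (per i t) ⟨
      refl⟨ n ⟩ (v i) (v j) (v (i + t * + n)) ∎
      where open ≡-Reasoning
    ... | no x≁i with x ∼? j
    ...   | yes (by t refl) = begin
      v (refl⟨ n ⟩ i j (j + t * + n))       ≡⟨ cong v (refl⟨⟩-j i j t i≁j) ⟩
      v (i + t * + n)                       ≡⟨ per i t ⟩
      v i + t * + n                         ≡⟨ refl⟨⟩-j (v i) (v j) t (i≁j ∘ ∼-reflect) ⟨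
      refl⟨ n ⟩ (v i) (v j) (v j + t * + n) ≡⟨ cong (refl⟨ n ⟩ (v i) (v j)) (per j t) ⟨
      refl⟨ n ⟩ (v i) (v j) (v (j + t * + n)) ∎
      where open ≡-Reasoning
    ...   | no x≁j = trans (cong v (refl⟨⟩-fix x≁i x≁j)) (sym (refl⟨⟩-fix (x≁i ∘ ∼-reflect) (x≁j ∘ ∼-reflect)))

module Parameters (m : ℕ) where
  M : ℕ
  M = suc m

  n : ℕ
  n = suc M

  N : ℕ
  N = n ℕ.* M

  1<n : 1 < n
  1<n = s≤s (s≤s z≤n)

  p<p+M : ∀ p → p < p ℕ.+ M
  p<p+M p = ℕP.m<m+n p (s≤s z≤n)

  Carries : ℕ → ℕ → Set
  Carries p i = ∃ λ r → p ≡ i ℕ.+ r ℕ.* n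

module SimpleReflection (m : ℕ) where
  open Parameters m
  open Modular n
  open Reflection n

  S : ℕ → Aff
  S p = refl⟨ n ⟩ (+ p) (+ suc p)

  p≁1+p : ∀ p → ¬ + p ∼ + suc p
  p≁1+p p = subst (λ x → ¬ + p ∼ x) (cong +_ (ℕP.+-comm p 1)) (≁+small (+ p) (s≤s z≤n) 1<n)

  S-periodic : ∀ p → Periodic (S p)
  S-periodic p = refl⟨⟩-periodic (p≁1+p p)

  S-involutive : ∀ p k → S p (S p k) ≡ k
  S-involutive p = refl⟨⟩-involutive (p≁1+p p)

  private
    cancel : ∀ a b → a - a + b ≡ b
    cancel = solve-∀

  S-p : ∀ p → S p (+ p) ≡ + suc p
  S-p p = trans (refl⟨⟩-∼i (∼-refl (+ p))) (cancel (+ p) (+ suc p))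

  S-1+p : ∀ p → S p (+ suc p) ≡ + p
  S-1+p p = trans (refl⟨⟩-∼j (p≁1+p p ∘ ∼-sym) (∼-refl (+ suc p))) (cancel (+ suc p) (+ p))

  sᵢ≈S : ∀ {p} i → Carries p i → ∀ k → sᵢ n i k ≡ S p k
  sᵢ≈S {p} i (r , p≡i+rn) k = sym (trans (cong₂ (λ x y → refl⟨ n ⟩ x y k) (cast p≡i+rn) (cast (cong suc p≡i+rn)))
                                          (refl⟨⟩-translate (+ i) (+ suc i) (+ r) k))
    where
    cast : ∀ {q j} → q ≡ j ℕ.+ r ℕ.* n → + q ≡ + j + + r * + n
    cast {j = j} refl = trans (ℤP.pos-+ j (r ℕ.* n)) (cong (_+_ (+ j)) (ℤP.pos-* r n))

module Prefix (m : ℕ) (taken : ℕ → Bool) where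
  open Parameters m
  open Modular n
  open Reflection n
  open SimpleReflection m

  prefix : ℕ → Aff
  prefix zero    = id
  prefix (suc p) = if taken p then prefix p ∘ S p else prefix p

  prefix⁻¹ : ℕ → Aff
  prefix⁻¹ zero    = id
  prefix⁻¹ (suc p) = if taken p then S p ∘ prefix⁻¹ p else prefix⁻¹ p

  prefix-take : ∀ {p} → taken p ≡ true → ∀ k → prefix (suc p) k ≡ prefix p (S p k)
  prefix-take eq k rewrite eq = refl

  prefix-skip : ∀ {p} → taken p ≡ false → ∀ k → prefix (suc p) k ≡ prefix p k
  prefix-skip eq k rewrite eq = refl

  prefix⁻¹-take : ∀ {p} → taken p ≡ true → ∀ k → prefix⁻¹ (suc p) k ≡ S p (prefix⁻¹ p k)
  prefix⁻¹-take eq k rewrite eq = refl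

  prefix⁻¹-skip : ∀ {p} → taken p ≡ false → ∀ k → prefix⁻¹ (suc p) k ≡ prefix⁻¹ p k
  prefix⁻¹-skip eq k rewrite eq = refl

  prefix-periodic : ∀ p → Periodic (prefix p)
  prefix-periodic zero    k t = refl
  prefix-periodic (suc p) k t with taken p
  ... | true  = trans (cong (prefix p) (S-periodic p k t)) (prefix-periodic p (S p k) t)
  ... | false = prefix-periodic p k t

  prefix⁻¹-prefix : ∀ p k → prefix⁻¹ p (prefix p k) ≡ k
  prefix⁻¹-prefix zero    k = refl
  prefix⁻¹-prefix (suc p) k with taken p
  ... | true  = trans (cong (S p) (prefix⁻¹-prefix p (S p k))) (S-involutive p k)
  ... | false = prefix⁻¹-prefix p k

  prefix-prefix⁻¹ : ∀ p k → prefix p (prefix⁻¹ p k) ≡ k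
  prefix-prefix⁻¹ zero    k = refl
  prefix-prefix⁻¹ (suc p) k with taken p
  ... | true  = trans (cong (prefix p) (S-involutive p (prefix⁻¹ p k))) (prefix-prefix⁻¹ p k)
  ... | false = prefix-prefix⁻¹ p k

  a : ℕ → ℤ
  a p = prefix p (+ p)

  b : ℕ → ℤ
  b p = prefix p (+ suc p)

  a≁b : ∀ p → ¬ a p ∼ b p
  a≁b p = p≁1+p p ∘ ∼-reflect {prefix p} {prefix⁻¹ p} (prefix-periodic p) (prefix⁻¹-prefix p)

  prefix-conjugate-S : ∀ p k → prefix p (S p (prefix⁻¹ p k)) ≡ refl⟨ n ⟩ (a p) (b p) k
  prefix-conjugate-S p k =
    trans (refl⟨⟩-conjugate {prefix p} {prefix⁻¹ p} (prefix-periodic p) (prefix⁻¹-prefix p) (p≁1+p p) (prefix⁻¹ p k))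
          (cong (refl⟨ n ⟩ (a p) (b p)) (prefix-prefix⁻¹ p k))

  prefix-suc-fix : ∀ {p k} → ¬ k ∼ + p → ¬ k ∼ + suc p → prefix (suc p) k ≡ prefix p k
  prefix-suc-fix {p} k≁p k≁1+p with taken p
  ... | true  = cong (prefix p) (refl⟨⟩-fix k≁p k≁1+p)
  ... | false = refl

  prefix-stable : ∀ d p k → (∀ r → p ≤ r → r ≤ d ℕ.+ p → ¬ k ∼ + r) → prefix (d ℕ.+ p) k ≡ prefix p k
  prefix-stable zero    p k k≁ = refl
  prefix-stable (suc d) p k k≁ =
    trans (prefix-suc-fix (k≁ (d ℕ.+ p) (ℕP.m≤n+m p d) (ℕP.n≤1+n _)) (k≁ (suc d ℕ.+ p) (ℕP.m≤n+m p (suc d)) ℕP.≤-refl))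
          (prefix-stable d p k (λ r p≤r r≤d+p → k≁ r p≤r (ℕP.m≤n⇒m≤1+n r≤d+p)))

  -- P - M ≡ P + 1 (mod n) is incongruent to each of the M integers P + 1 - M, …, P.
  window-≁ : ∀ {P r} → suc P ≤ M ℕ.+ r → r ≤ P → ¬ + P - + M ∼ + r
  window-≁ {P} {r} 1+P≤M+r r≤P = subst (λ x → ¬ + P - + M ∼ x) (sym r≡) (≁+small (+ P - + M) 0<d d<n)
    where
    d = M ℕ.+ r ℕ.∸ P
    P+d≡M+r : P ℕ.+ d ≡ M ℕ.+ r
    P+d≡M+r = ℕP.m+[n∸m]≡n (ℕP.<⇒≤ 1+P≤M+r)
    0<d : 0 < d
    0<d = ℕP.+-cancelˡ-< P 0 d (subst₂ _<_ (sym (ℕP.+-identityʳ P)) (sym P+d≡M+r) 1+P≤M+r)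
    d<n : d < n
    d<n = s≤s (ℕP.+-cancelˡ-≤ P d M (subst₂ _≤_ (sym P+d≡M+r) (ℕP.+-comm M P) (ℕP.+-monoʳ-≤ M r≤P)))
    r≡ : + r ≡ + P - + M + + d
    r≡ = i+j≡k+l⇒l≡i-k+j (+ P) (+ d) (+ M) (+ r) (trans (sym (ℤP.pos-+ P d)) (trans (cong +_ P+d≡M+r) (ℤP.pos-+ M r)))

  z : ℕ → ℤ
  z P = prefix (suc P ℕ.∸ M) (+ P - + M)

  z-stable : ∀ {P p} → p ≤ P → P < p ℕ.+ M → prefix p (+ P - + M) ≡ z P
  z-stable {P} {p} p≤P P<p+M = subst (λ q → prefix q (+ P - + M) ≡ z P) (ℕP.m∸n+n≡m lo≤p)
    (prefix-stable (p ℕ.∸ lo) lo (+ P - + M) λ r lo≤r r≤p →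
      window-≁ (ℕP.≤-trans (ℕP.m≤n+m∸n (suc P) M) (ℕP.+-monoʳ-≤ M lo≤r))
               (ℕP.≤-trans r≤p (ℕP.≤-trans (ℕP.≤-reflexive (ℕP.m∸n+n≡m lo≤p)) p≤P)))
    where
    lo = suc P ℕ.∸ M
    lo≤p : lo ≤ p
    lo≤p = ℕP.m≤n+o⇒m∸n≤o (suc P) M (subst (suc P ≤_) (ℕP.+-comm p M) P<p+M)

  b≡z+n : ∀ p → b p ≡ z p + + n
  b≡z+n p = begin
    prefix p (+ suc p)                   ≡⟨ cong (prefix p) (shift (+ p) (+ M)) ⟩
    prefix p (+ p - + M + 1ℤ * + n)      ≡⟨ prefix-periodic p (+ p - + M) 1ℤ ⟩
    prefix p (+ p - + M) + 1ℤ * + n      ≡⟨ cong₂ _+_ (z-stable ℕP.≤-refl (p<p+M p)) (ℤP.*-identityˡ (+ n)) ⟩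
    z p + + n                            ∎
    where
    open ≡-Reasoning
    shift : ∀ p M → 1ℤ + p ≡ p - M + 1ℤ * (1ℤ + M)
    shift = solve-∀

  z-initial : ∀ {P} → P < M → z P ≡ + P - + M
  z-initial {P} P<M = cong (λ q → prefix q (+ P - + M)) (ℕP.m≤n⇒m∸n≡0 P<M)

  private
    z[p+M] : ∀ p → z (p ℕ.+ M) ≡ prefix (suc p) (+ p)
    z[p+M] p = cong₂ prefix (ℕP.m+n∸n≡m (suc p) M) (trans (cong (_- + M) (ℤP.pos-+ p M)) (cancel (+ p) (+ M)))
      where
      cancel : ∀ p M → p + M - M ≡ p
      cancel = solve-∀

  z-take : ∀ {p} → taken p ≡ true → z (p ℕ.+ M) ≡ b p
  z-take {p} eq = trans (z[p+M] p) (trans (prefix-take eq (+ p)) (cong (prefix p) (S-p p)))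

  a-take : ∀ {p} → taken p ≡ true → a (suc p) ≡ a p
  a-take {p} eq = trans (prefix-take eq (+ suc p)) (cong (prefix p) (S-1+p p))

  z-skip : ∀ {p} → taken p ≡ false → z (p ℕ.+ M) ≡ a p
  z-skip {p} eq = trans (z[p+M] p) (prefix-skip eq (+ p))

  a-skip : ∀ {p} → taken p ≡ false → a (suc p) ≡ b p
  a-skip {p} eq = prefix-skip eq (+ suc p)

module Staircase (m : ℕ) where
  open Parameters m
  open ≡-Reasoning

  Ψ : ℕ → ℤ
  Ψ P = + (P ℕ.+ P ℕ./ M) - + M

  Ψ-+* : ∀ P k → Ψ (P ℕ.+ k ℕ.* M) ≡ Ψ P + + k * + n
  Ψ-+* P k = begin
    + (P ℕ.+ k ℕ.* M ℕ.+ (P ℕ.+ k ℕ.* M) ℕ./ M) - + M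
      ≡⟨ cong (λ q → + (P ℕ.+ k ℕ.* M ℕ.+ q) - + M) quotient ⟩
    + (P ℕ.+ k ℕ.* M ℕ.+ (P ℕ./ M ℕ.+ k)) - + M
      ≡⟨ cong (_- + M) casts ⟩
    + P + + k * + M + (+ (P ℕ./ M) + + k) - + M
      ≡⟨ collect (+ P) (+ (P ℕ./ M)) (+ k) (+ M) ⟩
    + P + + (P ℕ./ M) - + M + + k * (1ℤ + + M)
      ≡⟨ cong (λ x → x - + M + + k * + n) (ℤP.pos-+ P (P ℕ./ M)) ⟨
    Ψ P + + k * + n ∎
    where
    quotient : (P ℕ.+ k ℕ.* M) ℕ./ M ≡ P ℕ./ M ℕ.+ k
    quotient = trans (ℕDM.+-distrib-/-∣ʳ P (ℕD.n∣m*n k)) (cong (P ℕ./ M ℕ.+_) (ℕDM.m*n/n≡m k M))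
    casts : + (P ℕ.+ k ℕ.* M ℕ.+ (P ℕ./ M ℕ.+ k)) ≡ + P + + k * + M + (+ (P ℕ./ M) + + k)
    casts = trans (ℤP.pos-+ (P ℕ.+ k ℕ.* M) _)
              (cong₂ _+_ (trans (ℤP.pos-+ P (k ℕ.* M)) (cong (_+_ (+ P)) (ℤP.pos-* k M))) (ℤP.pos-+ (P ℕ./ M) k))
    collect : ∀ p q k M → p + k * M + (q + k) - M ≡ p + q - M + k * (1ℤ + M)
    collect = solve-∀

  Ψ-+M : ∀ P → Ψ (P ℕ.+ M) ≡ Ψ P + + n
  Ψ-+M P = begin
    Ψ (P ℕ.+ M)          ≡⟨ cong (λ x → Ψ (P ℕ.+ x)) (ℕP.*-identityˡ M) ⟨
    Ψ (P ℕ.+ 1 ℕ.* M)    ≡⟨ Ψ-+* P 1 ⟩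
    Ψ P + 1ℤ * + n       ≡⟨ cong (_+_ (Ψ P)) (ℤP.*-identityˡ (+ n)) ⟩
    Ψ P + + n            ∎

  Ψ-low : ∀ {P} → P < M → Ψ P ≡ + P - + M
  Ψ-low {P} P<M = cong (λ q → + q - + M) (trans (cong (P ℕ.+_) (ℕDM.m<n⇒m/n≡0 P<M)) (ℕP.+-identityʳ P))

  Ψ-M : Ψ M ≡ 1ℤ
  Ψ-M = trans (Ψ-+M 0) (trans (cong (_+ + n) (Ψ-low (s≤s z≤n))) (cancel (+ M)))
    where
    cancel : ∀ M → 0ℤ - M + (1ℤ + M) ≡ 1ℤ
    cancel = solve-∀

  Ψ-high : ∀ {P} → N ≤ P → P < N ℕ.+ M → Ψ P ≡ + P - + M + + n
  Ψ-high {P} N≤P P<N+M = begin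
    Ψ P                              ≡⟨ cong Ψ P≡r+nM ⟨
    Ψ (r ℕ.+ n ℕ.* M)                ≡⟨ Ψ-+* r n ⟩
    Ψ r + + n * + n                  ≡⟨ cong (_+ + n * + n) (Ψ-low r<M) ⟩
    + r - + M + + n * + n            ≡⟨ collect (+ r) (+ M) ⟩
    + r + + n * + M - + M + + n      ≡⟨ cong (λ x → x - + M + + n) casts ⟨
    + (r ℕ.+ n ℕ.* M) - + M + + n    ≡⟨ cong (λ x → + x - + M + + n) P≡r+nM ⟩
    + P - + M + + n                  ∎
    where
    r = P ℕ.∸ N
    P≡r+nM : r ℕ.+ N ≡ P
    P≡r+nM = ℕP.m∸n+n≡m N≤P
    r<M : r < M
    r<M = ℕP.+-cancelʳ-< N r M (subst₂ _<_ (sym P≡r+nM) (ℕP.+-comm N M) P<N+M)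
    casts : + (r ℕ.+ n ℕ.* M) ≡ + r + + n * + M
    casts = trans (ℤP.pos-+ r (n ℕ.* M)) (cong (_+_ (+ r)) (ℤP.pos-* n M))
    collect : ∀ r M → r - M + (1ℤ + M) * (1ℤ + M) ≡ r + (1ℤ + M) * M - M + (1ℤ + M)
    collect = solve-∀

  Ψ-suc : ∀ P → Ψ P ℤ.< Ψ (suc P)
  Ψ-suc P = ℤP.+-monoˡ-< (- + M) (ℤ.+<+ (s≤s (ℕP.+-monoʳ-≤ P (ℕDM./-monoˡ-≤ M (ℕP.n≤1+n P)))))

  Ψ-mono : ∀ P → Ψ P ℤ.≤ Ψ (suc P)
  Ψ-mono P = ℤP.<⇒≤ (Ψ-suc P)

isSkip : Bool → ℤ
isSkip true  = 0ℤ
isSkip false = 1ℤ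

module Counting (m : ℕ) where
  open Parameters m
  open Staircase m

  record Trajectory (taken : ℕ → Bool) (a b z : ℕ → ℤ) : Set where
    field
      b≡z+n     : ∀ p → b p ≡ z p + + n
      z-take    : ∀ {p} → taken p ≡ true → z (p ℕ.+ M) ≡ b p
      a-take    : ∀ {p} → taken p ≡ true → a (suc p) ≡ a p
      z-skip    : ∀ {p} → taken p ≡ false → z (p ℕ.+ M) ≡ a p
      a-skip    : ∀ {p} → taken p ≡ false → a (suc p) ≡ b p
      z-initial : ∀ {P} → P < M → z P ≡ + P - + M
      a-initial : a 0 ≡ 0ℤ
      z-final   : ∀ {P} → N ≤ P → P < N ℕ.+ M → z P ≡ + P - + M
      a-final   : a N ≡ + N
      b≢a+n     : ∀ p → b p ≢ a p + + n
      skips     : sumℤ N (isSkip ∘ taken) ≡ + (2 ℕ.* M)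

  module _ {taken a b z} (T : Trajectory taken a b z) where
    open Trajectory T
    open ℤP.≤-Reasoning

    private
      Upper : ℕ → Set
      Upper p = a p ℤ.< Ψ (p ℕ.+ M) × (∀ P → P < p ℕ.+ M → z P ℤ.≤ Ψ P)

      b≤Ψ : ∀ p → z p ℤ.≤ Ψ p → b p ℤ.≤ Ψ (p ℕ.+ M)
      b≤Ψ p z≤Ψ = begin
        b p           ≡⟨ b≡z+n p ⟩
        z p + + n     ≤⟨ ℤP.+-monoˡ-≤ (+ n) z≤Ψ ⟩
        Ψ p + + n     ≡⟨ Ψ-+M p ⟨
        Ψ (p ℕ.+ M)   ∎

      extend : ∀ {p} → (∀ P → P < p ℕ.+ M → z P ℤ.≤ Ψ P) → z (p ℕ.+ M) ℤ.≤ Ψ (p ℕ.+ M) →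
               ∀ P → P < suc p ℕ.+ M → z P ℤ.≤ Ψ P
      extend z≤Ψ new P P<1+p+M with ℕP.m<1+n⇒m<n∨m≡n P<1+p+M
      ... | inj₁ P<p+M = z≤Ψ P P<p+M
      ... | inj₂ refl  = new

      upper : ∀ p → Upper p
      upper zero = subst₂ ℤ._<_ (sym a-initial) (sym Ψ-M) (ℤ.+<+ (s≤s z≤n))
                 , λ P P<M → ℤP.≤-reflexive (trans (z-initial P<M) (sym (Ψ-low P<M)))
      upper (suc p) with upper p | taken p in eq
      ... | a<Ψ , z≤Ψ | true  = a[1+p]<Ψ , extend z≤Ψ (subst (ℤ._≤ _) (sym (z-take eq)) (b≤Ψ p (z≤Ψ p (p<p+M p))))
        where
        a[1+p]<Ψ : a (suc p) ℤ.< Ψ (suc p ℕ.+ M)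
        a[1+p]<Ψ = begin-strict
          a (suc p)          ≡⟨ a-take eq ⟩
          a p                <⟨ a<Ψ ⟩
          Ψ (p ℕ.+ M)        ≤⟨ Ψ-mono (p ℕ.+ M) ⟩
          Ψ (suc p ℕ.+ M)    ∎
      ... | a<Ψ , z≤Ψ | false = a[1+p]<Ψ , extend z≤Ψ (subst (ℤ._≤ _) (sym (z-skip eq)) (ℤP.<⇒≤ a<Ψ))
        where
        a[1+p]<Ψ : a (suc p) ℤ.< Ψ (suc p ℕ.+ M)
        a[1+p]<Ψ = begin-strict
          a (suc p)          ≡⟨ a-skip eq ⟩
          b p                ≤⟨ b≤Ψ p (z≤Ψ p (p<p+M p)) ⟩
          Ψ (p ℕ.+ M)        <⟨ Ψ-suc (p ℕ.+ M) ⟩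
          Ψ (suc p ℕ.+ M)    ∎

    z≤Ψ : ∀ P → z P ℤ.≤ Ψ P
    z≤Ψ P = proj₂ (upper (suc P)) P (ℕP.m<n⇒m<1+n (p<p+M P))

    private
      Lower : ℕ → Set
      Lower p = (∀ P → p ≤ P → P < N ℕ.+ M → Ψ P ℤ.≤ z P + + n)
              × (∀ q → p ≤ q → q < N → Ψ (q ℕ.+ M) ℤ.≤ a (suc q) + + n)

      lower-N : Lower N
      lower-N = (λ P N≤P P<N+M → ℤP.≤-reflexive (trans (Ψ-high N≤P P<N+M) (cong (_+ + n) (sym (z-final N≤P P<N+M)))))
              , (λ q N≤q q<N → ⊥-elim (ℕP.<⇒≱ q<N N≤q))

      restrict : ∀ {p} {R : ℕ → Set} → R p → (∀ P → suc p ≤ P → R P) → ∀ P → p ≤ P → R P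
      restrict Rp R>p P p≤P with ℕP.m≤n⇒m<n∨m≡n p≤P
      ... | inj₁ p<P = R>p P p<P
      ... | inj₂ refl = Rp

      lower-step : ∀ {p} → p < N → Lower (suc p) → Lower p
      lower-step {p} p<N (Ψ≤z , Ψ≤a) =
          restrict {R = λ P → P < N ℕ.+ M → Ψ P ℤ.≤ z P + + n} (λ _ → Ψ≤z[p]) Ψ≤z
        , restrict {R = λ q → q < N → Ψ (q ℕ.+ M) ℤ.≤ a (suc q) + + n} (λ _ → Ψ≤a[1+p]) Ψ≤a
        where
        Ψ≤a[1+p] : Ψ (p ℕ.+ M) ℤ.≤ a (suc p) + + n
        Ψ≤a[1+p] with ℕP.m≤n⇒m<n∨m≡n p<N
        ... | inj₂ 1+p≡N = begin
          Ψ (p ℕ.+ M)              ≡⟨ Ψ-high N≤p+M (ℕP.+-monoˡ-< M p<N) ⟩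
          + (p ℕ.+ M) - + M + + n  ≡⟨ cong (λ x → x - + M + + n) (ℤP.pos-+ p M) ⟩
          + p + + M - + M + + n    ≡⟨ cong (_+ + n) (cancel (+ p) (+ M)) ⟩
          + p + + n                ≤⟨ ℤP.+-monoˡ-≤ (+ n) (ℤ.+≤+ (ℕP.<⇒≤ p<N)) ⟩
          + N + + n                ≡⟨ cong (_+ + n) (trans (cong a 1+p≡N) a-final) ⟨
          a (suc p) + + n          ∎
          where
          N≤p+M : N ≤ p ℕ.+ M
          N≤p+M = subst (_≤ p ℕ.+ M) 1+p≡N (p<p+M p)
          cancel : ∀ p M → p + M - M ≡ p
          cancel = solve-∀
        ... | inj₁ 1+p<N with taken (suc p) in eq
        ...   | true  = begin
          Ψ (p ℕ.+ M)              ≤⟨ Ψ-mono (p ℕ.+ M) ⟩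
          Ψ (suc p ℕ.+ M)          ≤⟨ Ψ≤a (suc p) ℕP.≤-refl 1+p<N ⟩
          a (suc (suc p)) + + n    ≡⟨ cong (_+ + n) (a-take eq) ⟩
          a (suc p) + + n          ∎
        ...   | false = begin
          Ψ (p ℕ.+ M)              ≤⟨ Ψ-mono (p ℕ.+ M) ⟩
          Ψ (suc p ℕ.+ M)          ≤⟨ Ψ≤z (suc p ℕ.+ M) (ℕP.m≤m+n (suc p) M) (ℕP.+-monoˡ-< M 1+p<N) ⟩
          z (suc p ℕ.+ M) + + n    ≡⟨ cong (_+ + n) (z-skip eq) ⟩
          a (suc p) + + n          ∎

        Ψ≤b : Ψ (p ℕ.+ M) ℤ.≤ b p + + n
        Ψ≤b with taken p in eq
        ... | true  = subst (λ x → Ψ (p ℕ.+ M) ℤ.≤ x + + n) (z-take eq)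
                        (Ψ≤z (p ℕ.+ M) (p<p+M p) (ℕP.+-monoˡ-< M p<N))
        ... | false = subst (λ x → Ψ (p ℕ.+ M) ℤ.≤ x + + n) (a-skip eq) Ψ≤a[1+p]

        Ψ≤z[p] : Ψ p ℤ.≤ z p + + n
        Ψ≤z[p] = +-cancelʳ-≤ (+ n) (subst₂ ℤ._≤_ (Ψ-+M p) (cong (_+ + n) (b≡z+n p)) Ψ≤b)

      lower : ∀ d p → p ℕ.+ d ≡ N → Lower p
      lower zero    p p+0≡N = subst Lower (trans (sym p+0≡N) (ℕP.+-identityʳ p)) lower-N
      lower (suc d) p p+1+d≡N =
        lower-step (subst (p <_) p+1+d≡N (ℕP.m<m+n p (s≤s z≤n))) (lower d (suc p) (trans (sym (ℕP.+-suc p d)) p+1+d≡N))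

    Ψ≤z+n : ∀ P → P < N ℕ.+ M → Ψ P ℤ.≤ z P + + n
    Ψ≤z+n P = proj₁ (lower N 0 refl) P z≤n

    b≤a+n : ∀ {p} → p < N → taken p ≡ false → b p ℤ.≤ a p + + n
    b≤a+n {p} p<N eq = begin
      b p               ≤⟨ b≤Ψ p (z≤Ψ p) ⟩
      Ψ (p ℕ.+ M)       ≤⟨ Ψ≤z+n (p ℕ.+ M) (ℕP.+-monoˡ-< M p<N) ⟩
      z (p ℕ.+ M) + + n ≡⟨ cong (_+ + n) (z-skip eq) ⟩
      a p + + n         ∎

    gap : ℕ → ℤ
    gap p = if taken p then 0ℤ else b p - a p

    gap-skip : ∀ {p} → taken p ≡ false → gap p ≡ b p - a p
    gap-skip eq rewrite eq = refl

    gap-step : ∀ p → z (p ℕ.+ M) + gap p ≡ z p + + n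
    gap-step p with taken p in eq
    ... | true  = trans (ℤP.+-identityʳ _) (trans (z-take eq) (b≡z+n p))
    ... | false = trans (cong (_+ (b p - a p)) (z-skip eq)) (trans (cancel (a p) (b p)) (b≡z+n p))
      where
      cancel : ∀ a b → a + (b - a) ≡ b
      cancel = solve-∀

    gap≤M*isSkip : ∀ {p} → p < N → gap p ℤ.≤ + M * isSkip (taken p)
    gap≤M*isSkip {p} p<N with taken p in eq
    ... | true  = ℤP.≤-reflexive (sym (ℤP.*-zeroʳ (+ M)))
    ... | false = +-cancelʳ-≤ (a p + 1ℤ) (subst₂ ℤ._≤_ (sym (lhs (a p) (b p))) (sym (rhs (a p) (+ M)))
                    (ℤP.i<j⇒suc[i]≤j (ℤP.≤∧≢⇒< (b≤a+n p<N eq) (b≢a+n p))))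
      where
      lhs : ∀ a b → b - a + (a + 1ℤ) ≡ 1ℤ + b
      lhs = solve-∀
      rhs : ∀ a M → M * 1ℤ + (a + 1ℤ) ≡ a + (1ℤ + M)
      rhs = solve-∀

    telescope : ∀ s j → z (j ℕ.* M ℕ.+ s) + sumℤ j (λ i → gap (i ℕ.* M ℕ.+ s)) ≡ z s + + j * + n
    telescope s zero    = cong (_+_ (z s)) (sym (ℤP.*-zeroˡ (+ n)))
    telescope s (suc j) = begin-equality
      z (suc j ℕ.* M ℕ.+ s) + (Σⱼ + gap p) ≡⟨ cong (λ q → z q + (Σⱼ + gap p)) p+M≡ ⟨
      z (p ℕ.+ M) + (Σⱼ + gap p)           ≡⟨ swap₁ (z (p ℕ.+ M)) Σⱼ (gap p) ⟩
      z (p ℕ.+ M) + gap p + Σⱼ             ≡⟨ cong (_+ Σⱼ) (gap-step p) ⟩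
      z p + + n + Σⱼ                       ≡⟨ swap₂ (z p) (+ n) Σⱼ ⟩
      z p + Σⱼ + + n                       ≡⟨ cong (_+ + n) (telescope s j) ⟩
      z s + + j * + n + + n                ≡⟨ collect (z s) (+ j) (+ n) ⟩
      z s + + suc j * + n                  ∎
      where
      p = j ℕ.* M ℕ.+ s
      Σⱼ = sumℤ j (λ i → gap (i ℕ.* M ℕ.+ s))
      p+M≡ : p ℕ.+ M ≡ suc j ℕ.* M ℕ.+ s
      p+M≡ = trans (ℕP.+-comm p M) (sym (ℕP.+-assoc M (j ℕ.* M) s))
      swap₁ : ∀ x y w → x + (y + w) ≡ x + w + y
      swap₁ = solve-∀
      swap₂ : ∀ x y w → x + y + w ≡ x + w + y
      swap₂ = solve-∀
      collect : ∀ x j n → x + j * n + n ≡ x + (1ℤ + j) * n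
      collect = solve-∀

    class-sum : ∀ {s} → s < M → sumℤ n (λ i → gap (i ℕ.* M ℕ.+ s)) ≡ + n
    class-sum {s} s<M = +-cancelˡ-≡ (+ n * + M + + s - + M) _ (+ n) (begin-equality
      + n * + M + + s - + M + Σₛ ≡⟨ cong (λ x → x - + M + Σₛ) casts ⟨
      + (N ℕ.+ s) - + M + Σₛ     ≡⟨ cong (_+ Σₛ) (z-final (ℕP.m≤m+n N s) (ℕP.+-monoʳ-< N s<M)) ⟨
      z (N ℕ.+ s) + Σₛ           ≡⟨ telescope s n ⟩
      z s + + n * + n           ≡⟨ cong (_+ + n * + n) (z-initial s<M) ⟩
      + s - + M + + n * + n     ≡⟨ collect (+ s) (+ M) ⟩
      + n * + M + + s - + M + + n ∎)
      where
      Σₛ = sumℤ n (λ i → gap (i ℕ.* M ℕ.+ s))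
      casts : + (N ℕ.+ s) ≡ + n * + M + + s
      casts = trans (ℤP.pos-+ N s) (cong (_+ + s) (ℤP.pos-* n M))
      collect : ∀ s M → s - M + (1ℤ + M) * (1ℤ + M) ≡ (1ℤ + M) * M + s - M + (1ℤ + M)
      collect = solve-∀

    skipsIn : ℕ → ℤ
    skipsIn s = sumℤ n (λ i → isSkip (taken (i ℕ.* M ℕ.+ s)))

    private
      class-member<N : ∀ {s i} → s < M → i < n → i ℕ.* M ℕ.+ s < N
      class-member<N {s} {i} s<M i<n = ℕP.<-≤-trans (ℕP.+-monoʳ-< (i ℕ.* M) s<M)
                                         (subst (_≤ N) (ℕP.+-comm M (i ℕ.* M)) (ℕP.*-monoˡ-≤ M i<n))

      gap≤M*isSkip-class : ∀ {s} → s < M → ∀ i → i < n → gap (i ℕ.* M ℕ.+ s) ℤ.≤ + M * isSkip (taken (i ℕ.* M ℕ.+ s))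
      gap≤M*isSkip-class s<M i i<n = gap≤M*isSkip (class-member<N s<M i<n)

      n≰M : ¬ + n ℤ.≤ + M
      n≰M = ℤP.<⇒≱ (ℤ.+<+ ℕP.≤-refl)

    n≤M*skipsIn : ∀ {s} → s < M → + n ℤ.≤ + M * skipsIn s
    n≤M*skipsIn {s} s<M = begin
      + n                                                   ≡⟨ class-sum s<M ⟨
      sumℤ n (λ i → gap (i ℕ.* M ℕ.+ s))                     ≤⟨ sumℤ-mono-≤ n (gap≤M*isSkip-class s<M) ⟩
      sumℤ n (λ i → + M * isSkip (taken (i ℕ.* M ℕ.+ s)))     ≡⟨ sumℤ-*ˡ n (+ M) _ ⟩
      + M * skipsIn s                                       ∎

    2≤skipsIn : ∀ {s} → s < M → + 2 ℤ.≤ skipsIn s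
    2≤skipsIn {s} s<M with + 2 ℤ.≤? skipsIn s
    ... | yes 2≤k = 2≤k
    ... | no  2≰k = ⊥-elim (n≰M (begin
      + n              ≤⟨ n≤M*skipsIn s<M ⟩
      + M * skipsIn s  ≤⟨ ℤP.*-monoˡ-≤-nonNeg (+ M) (ℤP.i<j⇒i≤pred[j] (ℤP.≰⇒> 2≰k)) ⟩
      + M * 1ℤ         ≡⟨ ℤP.*-identityʳ (+ M) ⟩
      + M              ∎))

    skipsIn-total : sumℤ M skipsIn ≡ + (2 ℕ.* M)
    skipsIn-total = begin-equality
      sumℤ M skipsIn                                              ≡⟨ sumℤ-swap n M (λ i s → isSkip (taken (i ℕ.* M ℕ.+ s))) ⟨
      sumℤ n (λ i → sumℤ M (λ s → isSkip (taken (i ℕ.* M ℕ.+ s)))) ≡⟨ sumℤ-blocks n M (isSkip ∘ taken) ⟨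
      sumℤ N (isSkip ∘ taken)                                     ≡⟨ skips ⟩
      + (2 ℕ.* M)                                                 ∎

    skipsIn≤2 : ∀ {s} → s < M → skipsIn s ℤ.≤ + 2
    skipsIn≤2 {s} s<M = ℤP.i-j≤0⇒i≤j (+-cancelʳ-≤ (+ M * + 2) (begin
      skipsIn s - + 2 + + M * + 2          ≡⟨ ℤP.+-comm (skipsIn s - + 2) (+ M * + 2) ⟩
      + M * + 2 + (skipsIn s - + 2)        ≡⟨ cong (_+ (skipsIn s - + 2)) (sumℤ-const M (+ 2)) ⟨
      sumℤ M (λ _ → + 2) + (skipsIn s - + 2) ≤⟨ sumℤ-mono-≤-gap M (skipsIn s - + 2) (λ s′ s′<M → 2≤skipsIn s′<M) s<M
                                                 (ℤP.≤-reflexive (cancel (skipsIn s))) ⟩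
      sumℤ M skipsIn                       ≡⟨ skipsIn-total ⟩
      + (2 ℕ.* M)                          ≡⟨ ℤP.pos-* 2 M ⟩
      + 2 * + M                            ≡⟨ ℤP.*-comm (+ 2) (+ M) ⟩
      + M * + 2                            ≡⟨ ℤP.+-identityˡ (+ M * + 2) ⟨
      0ℤ + + M * + 2                       ∎))
      where
      cancel : ∀ k → + 2 + (k - + 2) ≡ k
      cancel = solve-∀

    1≤gap : ∀ {p} → p < N → taken p ≡ false → 1ℤ ℤ.≤ gap p
    1≤gap {p} p<N eq with 1ℤ ℤ.≤? gap p
    ... | yes 1≤gap[p] = 1≤gap[p]
    ... | no  1≰gap[p] = ⊥-elim (n≰M (+-cancelʳ-≤ (+ M) (begin
      + n + + M                                           ≡⟨ cong (_+ + M) (class-sum s<M) ⟨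
      sumℤ n (λ i → gap (i ℕ.* M ℕ.+ s)) + + M             ≤⟨ sumℤ-mono-≤-gap n (+ M) (gap≤M*isSkip-class s<M) j<n
                                                               (subst (λ q → gap q + + M ℤ.≤ + M * isSkip (taken q)) (sym jM+s≡p) gap+M≤) ⟩
      sumℤ n (λ i → + M * isSkip (taken (i ℕ.* M ℕ.+ s)))   ≡⟨ sumℤ-*ˡ n (+ M) _ ⟩
      + M * skipsIn s                                     ≤⟨ ℤP.*-monoˡ-≤-nonNeg (+ M) (skipsIn≤2 s<M) ⟩
      + M * + 2                                           ≡⟨ double (+ M) ⟩
      + M + + M                                           ∎)))
      where
      s = p ℕ.% M
      j = p ℕ./ M
      s<M : s < M
      s<M = ℕDM.m%n<n p M
      j<n : j < n
      j<n = ℕDM.m<n*o⇒m/o<n p<N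
      jM+s≡p : j ℕ.* M ℕ.+ s ≡ p
      jM+s≡p = trans (ℕP.+-comm (j ℕ.* M) s) (sym (ℕDM.m≡m%n+[m/n]*n p M))
      double : ∀ M → M * + 2 ≡ M + M
      double = solve-∀
      gap+M≤ : gap p + + M ℤ.≤ + M * isSkip (taken p)
      gap+M≤ = begin
        gap p + + M                ≤⟨ ℤP.+-monoˡ-≤ (+ M) (ℤP.i<j⇒i≤pred[j] (ℤP.≰⇒> 1≰gap[p])) ⟩
        0ℤ + + M                   ≡⟨ ℤP.+-identityˡ (+ M) ⟩
        + M                        ≡⟨ ℤP.*-identityʳ (+ M) ⟨
        + M * isSkip false         ≡⟨ cong (λ β → + M * isSkip β) eq ⟨
        + M * isSkip (taken p)     ∎

    a<b : ∀ {p} → p < N → taken p ≡ false → a p ℤ.< b p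
    a<b {p} p<N eq = ℤP.suc[i]≤j⇒i<j (subst (ℤ.suc (a p) ℤ.≤_) (cancel (a p) (b p))
                       (ℤP.+-monoˡ-≤ (a p) (subst (1ℤ ℤ.≤_) (gap-skip eq) (1≤gap p<N eq))))
      where
      cancel : ∀ a b → b - a + a ≡ b
      cancel = solve-∀

bit : Subword → ℕ → Bool
bit []      p       = true
bit (β ∷ u) zero    = β
bit (β ∷ u) (suc p) = bit u p

module Positions (m : ℕ) where
  open Parameters m

  Residues : ℕ → List ℕ → Set
  Residues p []       = ⊤
  Residues p (i ∷ is) = Carries p i × Residues (suc p) is

  residues-applyUpTo : ∀ r k f → (∀ d → f d ≡ k ℕ.+ d) → ∀ d → Residues (r ℕ.* n ℕ.+ k) (applyUpTo f d)
  residues-applyUpTo r k f f≡ zero    = tt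
  residues-applyUpTo r k f f≡ (suc d) =
      (r , trans (ℕP.+-comm (r ℕ.* n) k) (cong (ℕ._+ r ℕ.* n) (sym (trans (f≡ 0) (ℕP.+-identityʳ k)))))
    , subst (λ q → Residues q (applyUpTo (f ∘ suc) d)) (ℕP.+-suc (r ℕ.* n) k)
        (residues-applyUpTo r (suc k) (f ∘ suc) (λ d → trans (f≡ (suc d)) (ℕP.+-suc k d)) d)

  residues-++ : ∀ {p} is {js} → Residues p is → Residues (p ℕ.+ length is) js → Residues p (is ++ js)
  residues-++ {p} []       {js} _          res-js = subst (λ q → Residues q js) (ℕP.+-identityʳ p) res-js
  residues-++ {p} (i ∷ is) {js} (r , res-is) res-js =
    r , residues-++ is res-is (subst (λ q → Residues q js) (ℕP.+-suc p (length is)) res-js)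

  residues-word : ∀ d r → Residues (r ℕ.* n) (concat (replicate d (upTo n)))
  residues-word zero    r = tt
  residues-word (suc d) r =
    residues-++ (upTo n)
      (subst (λ q → Residues q (upTo n)) (ℕP.+-identityʳ (r ℕ.* n)) (residues-applyUpTo r 0 id (λ _ → refl) n))
      (subst (λ q → Residues q (concat (replicate d (upTo n))))
             (trans (ℕP.+-comm n (r ℕ.* n)) (cong (r ℕ.* n ℕ.+_) (sym (length-upTo n))))
             (residues-word d (suc r)))

  length-word : ∀ d → length (concat (replicate d (upTo n))) ≡ d ℕ.* n
  length-word zero    = refl
  length-word (suc d) = trans (length-++ (upTo n)) (cong₂ ℕ._+_ (length-upTo n) (length-word d))

  Positions : ℕ → List (ℕ × Bool) → Set
  Positions p []             = p ≡ N
  Positions p ((i , _) ∷ xs) = Carries p i × Positions (suc p) xs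

  positions-zip : ∀ {p} is bs → Residues p is → length is ≡ length bs → p ℕ.+ length is ≡ N → Positions p (zip is bs)
  positions-zip {p} []       []       _         _   p+0≡N = trans (sym (ℕP.+-identityʳ p)) p+0≡N
  positions-zip {p} (i ∷ is) (β ∷ bs) (r , res) len end   =
    r , positions-zip is bs res (ℕP.suc-injective len) (trans (sym (ℕP.+-suc p (length is))) end)

  subwordProd : List (ℕ × Bool) → Aff
  subwordProd xs = prod (map (letter n) xs)

  wordProd : List (ℕ × Bool) → Aff
  wordProd xs = prod (map (sᵢ n ∘ proj₁) xs)

  positions-≤ : ∀ {p} xs → Positions p xs → p ≤ N
  positions-≤ []             p≡N       = ℕP.≤-reflexive p≡N
  positions-≤ ((i , _) ∷ xs) (_ , pos) = ℕP.<⇒≤ (positions-≤ xs pos)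

Bits : (ℕ → Bool) → ℕ → List (ℕ × Bool) → Set
Bits taken p []             = ⊤
Bits taken p ((_ , β) ∷ xs) = β ≡ taken p × Bits taken (suc p) xs

bits-zip : ∀ {taken} p (is : List ℕ) bs → (∀ k → bit bs k ≡ taken (p ℕ.+ k)) → Bits taken p (zip is bs)
bits-zip p []       bs       _     = tt
bits-zip p (i ∷ is) []       _     = tt
bits-zip {taken} p (i ∷ is) (β ∷ bs) bits≡ =
    trans (bits≡ 0) (cong taken (ℕP.+-identityʳ p))
  , bits-zip (suc p) is bs (λ k → trans (bits≡ (suc k)) (cong taken (ℕP.+-suc p k)))

sumℤ-isSkip : ∀ u → sumℤ (length u) (isSkip ∘ bit u) ≡ + countSkips u
sumℤ-isSkip []      = refl
sumℤ-isSkip (β ∷ u) = begin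
  sumℤ (suc (length u)) (isSkip ∘ bit (β ∷ u))      ≡⟨ sumℤ-split 1 (length u) (isSkip ∘ bit (β ∷ u)) ⟩
  0ℤ + isSkip β + sumℤ (length u) (isSkip ∘ bit u)  ≡⟨ cong₂ _+_ (ℤP.+-identityˡ (isSkip β)) (sumℤ-isSkip u) ⟩
  isSkip β + + countSkips u                         ≡⟨ head β ⟩
  + countSkips (β ∷ u)                              ∎
  where
  open ≡-Reasoning
  head : ∀ β → isSkip β + + countSkips u ≡ + countSkips (β ∷ u)
  head true  = ℤP.+-identityˡ _
  head false = refl

length-skipReflsFrom : ∀ n pre (is : List ℕ) bs → length is ≡ length bs → length (skipReflsFrom n pre (zip is bs)) ≡ countSkips bs
length-skipReflsFrom n pre []       []           _   = refl
length-skipReflsFrom n pre (i ∷ is) (true ∷ bs)  len = length-skipReflsFrom n (pre ++ [ i ]) is bs (ℕP.suc-injective len)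
length-skipReflsFrom n pre (i ∷ is) (false ∷ bs) len = cong suc (length-skipReflsFrom n pre is bs (ℕP.suc-injective len))

prod-++ : ∀ fs gs k → prod (fs ++ gs) k ≡ prod fs (prod gs k)
prod-++ []       gs k = refl
prod-++ (f ∷ fs) gs k = cong f (prod-++ fs gs k)

module FullWord (m : ℕ) where
  open Parameters m
  open Modular n
  open Reflection n
  open Staircase m
  open SimpleReflection m
  open Prefix m (λ _ → true)
  open Positions m
  open ≡-Reasoning

  a-full : ∀ p → a p ≡ 0ℤ
  a-full zero    = refl
  a-full (suc p) = trans (a-take {p} refl) (a-full p)

  z-full : ∀ j {r} → r < M → z (j ℕ.* M ℕ.+ r) ≡ Ψ (j ℕ.* M ℕ.+ r)
  z-full zero    r<M = trans (z-initial r<M) (sym (Ψ-low r<M))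
  z-full (suc j) {r} r<M = begin
    z (suc j ℕ.* M ℕ.+ r)   ≡⟨ cong z p+M≡ ⟨
    z (p ℕ.+ M)             ≡⟨ z-take {p} refl ⟩
    b p                     ≡⟨ b≡z+n p ⟩
    z p + + n               ≡⟨ cong (_+ + n) (z-full j r<M) ⟩
    Ψ p + + n               ≡⟨ Ψ-+M p ⟨
    Ψ (p ℕ.+ M)             ≡⟨ cong Ψ p+M≡ ⟩
    Ψ (suc j ℕ.* M ℕ.+ r)   ∎
    where
    p = j ℕ.* M ℕ.+ r
    p+M≡ : p ℕ.+ M ≡ suc j ℕ.* M ℕ.+ r
    p+M≡ = trans (ℕP.+-comm p M) (sym (ℕP.+-assoc M (j ℕ.* M) r))

  λ-periodic : Periodic λ⟨ n ⟩
  λ-periodic k t with k ∼? 0ℤ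
  ... | yes k∼0 = trans (if-∼ (∼-trans (+*n∼ k t) k∼0)) (trans (swap k (+ N) (t * + n)) (cong (_+ t * + n) (sym (if-∼ k∼0))))
    where
    swap : ∀ k N x → k + x - N ≡ k - N + x
    swap = solve-∀
  ... | no k≁0 = trans (if-≁ (k≁0 ∘ ∼-+*nˡ t)) (trans (swap k (+ n) (t * + n)) (cong (_+ t * + n) (sym (if-≁ k≁0))))
    where
    swap : ∀ k n x → k + x + n ≡ k + n + x
    swap = solve-∀

  N∼0 : + N ∼ 0ℤ
  N∼0 = by (+ M) (trans (ℤP.pos-* n M) (trans (ℤP.*-comm (+ n) (+ M)) (sym (ℤP.+-identityˡ _))))

  prefix-N-window : ∀ {P} → N ≤ P → P < N ℕ.+ M → prefix N (+ P - + M) ≡ λ⟨ n ⟩ (+ P - + M)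
  prefix-N-window {P} N≤P P<N+M = begin
    prefix N (+ P - + M)    ≡⟨ z-stable N≤P P<N+M ⟩
    z P                     ≡⟨ cong z P≡ ⟨
    z (n ℕ.* M ℕ.+ r)       ≡⟨ z-full n r<M ⟩
    Ψ (n ℕ.* M ℕ.+ r)       ≡⟨ cong Ψ P≡ ⟩
    Ψ P                     ≡⟨ Ψ-high N≤P P<N+M ⟩
    + P - + M + + n         ≡⟨ if-≁ P-M≁0 ⟨
    λ⟨ n ⟩ (+ P - + M)      ∎
    where
    r = P ℕ.∸ N
    P≡ : n ℕ.* M ℕ.+ r ≡ P
    P≡ = ℕP.m+[n∸m]≡n N≤P
    r<M : r < M
    r<M = ℕP.+-cancelˡ-< N r M (subst (_< N ℕ.+ M) (sym P≡) P<N+M)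
    P-M≁0 : ¬ + P - + M ∼ 0ℤ
    P-M≁0 P-M∼0 = window-≁ (subst (suc P ≤_) (ℕP.+-comm N M) P<N+M) N≤P (∼-trans P-M∼0 (∼-sym N∼0))

  prefix-N≈λ : ∀ k → prefix N k ≡ λ⟨ n ⟩ k
  prefix-N≈λ = periodic-ext (prefix N) λ⟨ n ⟩ (prefix-periodic N) λ-periodic (+ N - + M) agree
    where
    agree : ∀ r → r < n → prefix N (+ N - + M + + r) ≡ λ⟨ n ⟩ (+ N - + M + + r)
    agree r r<n with r ℕ.<? M
    ... | yes r<M = subst (λ x → prefix N x ≡ λ⟨ n ⟩ x) x≡ (prefix-N-window (ℕP.m≤m+n N r) (ℕP.+-monoʳ-< N r<M))
      where
      x≡ : + (N ℕ.+ r) - + M ≡ + N - + M + + r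
      x≡ = trans (cong (_- + M) (ℤP.pos-+ N r)) (swap (+ N) (+ r) (+ M))
        where
        swap : ∀ N r M → N + r - M ≡ N - M + r
        swap = solve-∀
    ... | no r≮M rewrite ℕP.≤-antisym (ℕP.≤-pred r<n) (ℕP.≮⇒≥ r≮M) = begin
      prefix N (+ N - + M + + M)   ≡⟨ cong (prefix N) (cancel (+ N) (+ M)) ⟩
      a N                          ≡⟨ a-full N ⟩
      0ℤ                           ≡⟨ ℤP.+-inverseʳ (+ N) ⟨
      + N - + N                    ≡⟨ if-∼ N∼0 ⟨
      λ⟨ n ⟩ (+ N)                 ≡⟨ cong λ⟨ n ⟩ (cancel (+ N) (+ M)) ⟨
      λ⟨ n ⟩ (+ N - + M + + M)     ∎
      where
      cancel : ∀ N M → N - M + M ≡ N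
      cancel = solve-∀

  prefix-wordProd : ∀ {p} xs → Positions p xs → ∀ k → prefix p (wordProd xs k) ≡ prefix N k
  prefix-wordProd [] p≡N k = cong (λ q → prefix q k) p≡N
  prefix-wordProd {p} ((i , _) ∷ xs) (letter , pos) k =
    trans (cong (prefix p) (sᵢ≈S i letter (wordProd xs k))) (prefix-wordProd xs pos k)

  wordProd≈λ : ∀ xs → Positions 0 xs → ∀ k → wordProd xs k ≡ λ⟨ n ⟩ k
  wordProd≈λ xs pos k = trans (prefix-wordProd xs pos k) (prefix-N≈λ k)

module Chain (n : ℕ) where

  ReflStep : Aff → ℤ → ℤ → Set
  ReflStep r x y = (r ≈ refl⟨ n ⟩ x y) × ¬ x ≡[mod n ] y × x ℤ.< y

  IsChain : (ℕ → ℤ) → List Aff → Set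
  IsChain x rs = ∀ (i : Fin (length rs)) → ReflStep (lookup rs i) (x (toℕ i)) (x (suc (toℕ i)))

  _◂_ : ℤ → (ℕ → ℤ) → ℕ → ℤ
  (c ◂ x) zero    = c
  (c ◂ x) (suc i) = x i

  chain-∷ : ∀ {r rs c x} → ReflStep r c (x 0) → IsChain x rs → IsChain (c ◂ x) (r ∷ rs)
  chain-∷ step chain Fin.zero    = step
  chain-∷ step chain (Fin.suc i) = chain i

module SkipReflections (m : ℕ) (taken : ℕ → Bool) where
  open Parameters m
  open Modular n
  open Chain n
  open SimpleReflection m
  open Prefix m taken
  open Positions m

  conjugateBy : List ℕ → ℕ → Aff
  conjugateBy pre i = prod (map (sᵢ n) pre) ∘ sᵢ n i ∘ prod (map (sᵢ n) (reverse pre))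

  record Spells (p : ℕ) (pre : List ℕ) : Set where
    constructor spells
    field
      prefix≈  : ∀ k → prod (map (sᵢ n) pre) k ≡ prefix p k
      prefix⁻¹≈ : ∀ k → prod (map (sᵢ n) (reverse pre)) k ≡ prefix⁻¹ p k

  spells-take : ∀ {p pre} i → Spells p pre → taken p ≡ true → Carries p i → Spells (suc p) (pre ++ [ i ])
  spells-take {p} {pre} i (spells pre≈ pre⁻¹≈) eq p≡ = spells pre+i≈ [pre+i]⁻¹≈
    where
    open ≡-Reasoning
    pre+i≈ : ∀ k → prod (map (sᵢ n) (pre ++ [ i ])) k ≡ prefix (suc p) k
    pre+i≈ k = begin
      prod (map (sᵢ n) (pre ++ [ i ])) k         ≡⟨ cong (λ fs → prod fs k) (map-++ (sᵢ n) pre [ i ]) ⟩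
      prod (map (sᵢ n) pre ++ [ sᵢ n i ]) k      ≡⟨ prod-++ (map (sᵢ n) pre) [ sᵢ n i ] k ⟩
      prod (map (sᵢ n) pre) (sᵢ n i k)           ≡⟨ pre≈ (sᵢ n i k) ⟩
      prefix p (sᵢ n i k)                        ≡⟨ cong (prefix p) (sᵢ≈S i p≡ k) ⟩
      prefix p (S p k)                           ≡⟨ prefix-take eq k ⟨
      prefix (suc p) k                           ∎
    [pre+i]⁻¹≈ : ∀ k → prod (map (sᵢ n) (reverse (pre ++ [ i ]))) k ≡ prefix⁻¹ (suc p) k
    [pre+i]⁻¹≈ k = begin
      prod (map (sᵢ n) (reverse (pre ++ [ i ]))) k   ≡⟨ cong (λ is → prod (map (sᵢ n) is) k) (reverse-++ pre [ i ]) ⟩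
      sᵢ n i (prod (map (sᵢ n) (reverse pre)) k)     ≡⟨ sᵢ≈S i p≡ (prod (map (sᵢ n) (reverse pre)) k) ⟩
      S p (prod (map (sᵢ n) (reverse pre)) k)        ≡⟨ cong (S p) (pre⁻¹≈ k) ⟩
      S p (prefix⁻¹ p k)                             ≡⟨ prefix⁻¹-take eq k ⟨
      prefix⁻¹ (suc p) k                             ∎

  spells-skip : ∀ {p pre} → Spells p pre → taken p ≡ false → Spells (suc p) pre
  spells-skip (spells pre≈ pre⁻¹≈) eq = spells (λ k → trans (pre≈ k) (sym (prefix-skip eq k)))
                                              (λ k → trans (pre⁻¹≈ k) (sym (prefix⁻¹-skip eq k)))

  conjugateBy≈ : ∀ {p pre} i → Spells p pre → Carries p i → ∀ k → conjugateBy pre i k ≡ prefix p (S p (prefix⁻¹ p k))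
  conjugateBy≈ {p} {pre} i (spells pre≈ pre⁻¹≈) p≡ k =
    trans (pre≈ _) (cong (prefix p) (trans (sᵢ≈S i p≡ (prod (map (sᵢ n) (reverse pre)) k)) (cong (S p) (pre⁻¹≈ k))))

  prefix-subwordProd : ∀ {p} xs → Positions p xs → Bits taken p xs → ∀ k → prefix p (subwordProd xs k) ≡ prefix N k
  prefix-subwordProd []                 p≡N        _            k = cong (λ q → prefix q k) p≡N
  prefix-subwordProd {p} ((i , true) ∷ xs) (letter , pos) (eq , bits) k = begin
    prefix p (sᵢ n i (subwordProd xs k))  ≡⟨ cong (prefix p) (sᵢ≈S i letter (subwordProd xs k)) ⟩
    prefix p (S p (subwordProd xs k))     ≡⟨ prefix-take (sym eq) (subwordProd xs k) ⟨
    prefix (suc p) (subwordProd xs k)     ≡⟨ prefix-subwordProd xs pos bits k ⟩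
    prefix N k                            ∎
    where open ≡-Reasoning
  prefix-subwordProd {p} ((i , false) ∷ xs) (_ , pos) (eq , bits) k =
    trans (sym (prefix-skip (sym eq) (subwordProd xs k))) (prefix-subwordProd xs pos bits k)

  -- At p = 0 this reads t_{j₁} ⋯ t_{jₖ} u = 𝛌ₙ.
  skipReflsFrom-prod : ∀ {p pre} xs → Positions p xs → Bits taken p xs → Spells p pre →
                       ∀ k → prod (skipReflsFrom n pre xs) (prefix p (subwordProd xs k)) ≡ prefix p (wordProd xs k)
  skipReflsFrom-prod [] _ _ _ k = refl
  skipReflsFrom-prod {p} {pre} ((i , true) ∷ xs) (letter , pos) (eq , bits) sp k = begin
    prod rest (prefix p (sᵢ n i (subwordProd xs k)))   ≡⟨ cong (prod rest) (take (subwordProd xs k)) ⟩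
    prod rest (prefix (suc p) (subwordProd xs k))      ≡⟨ skipReflsFrom-prod xs pos bits (spells-take i sp (sym eq) letter) k ⟩
    prefix (suc p) (wordProd xs k)                     ≡⟨ take (wordProd xs k) ⟨
    prefix p (sᵢ n i (wordProd xs k))                  ∎
    where
    open ≡-Reasoning
    rest = skipReflsFrom n (pre ++ [ i ]) xs
    take : ∀ k → prefix p (sᵢ n i k) ≡ prefix (suc p) k
    take k = trans (cong (prefix p) (sᵢ≈S i letter k)) (sym (prefix-take (sym eq) k))
  skipReflsFrom-prod {p} {pre} ((i , false) ∷ xs) (letter , pos) (eq , bits) sp k = begin
    conjugateBy pre i (prod rest (prefix p (subwordProd xs k)))       ≡⟨ cong (conjugateBy pre i ∘ prod rest) (prefix-skip (sym eq) _) ⟨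
    conjugateBy pre i (prod rest (prefix (suc p) (subwordProd xs k)))
      ≡⟨ cong (conjugateBy pre i) (skipReflsFrom-prod xs pos bits (spells-skip sp (sym eq)) k) ⟩
    conjugateBy pre i (prefix (suc p) (wordProd xs k))                ≡⟨ cong (conjugateBy pre i) (prefix-skip (sym eq) _) ⟩
    conjugateBy pre i (prefix p (wordProd xs k))                      ≡⟨ conjugateBy≈ i sp letter _ ⟩
    prefix p (S p (prefix⁻¹ p (prefix p (wordProd xs k))))            ≡⟨ cong (prefix p ∘ S p) (prefix⁻¹-prefix p _) ⟩
    prefix p (S p (wordProd xs k))                                    ≡⟨ cong (prefix p) (sᵢ≈S i letter (wordProd xs k)) ⟨
    prefix p (sᵢ n i (wordProd xs k))                                 ∎
    where
    open ≡-Reasoning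
    rest = skipReflsFrom n pre xs

  module _ (a<b : ∀ {p} → p < N → taken p ≡ false → a p ℤ.< b p) where

    skip-chain : ∀ {p pre} xs → Positions p xs → Bits taken p xs → Spells p pre →
                 ∃ λ x → x 0 ≡ a p × IsChain x (skipReflsFrom n pre xs)
    skip-chain {p} [] _ _ _ = (λ _ → a p) , refl , λ ()
    skip-chain {p} ((i , true) ∷ xs) (letter , pos) (eq , bits) sp
      with skip-chain xs pos bits (spells-take i sp (sym eq) letter)
    ... | x , x₀≡a , chain = x , trans x₀≡a (a-take (sym eq)) , chain
    skip-chain {p} {pre} ((i , false) ∷ xs) (letter , pos) (eq , bits) sp
      with skip-chain xs pos bits (spells-skip sp (sym eq))
    ... | x , x₀≡a , chain = a p ◂ x , refl , chain-∷ step chain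
      where
      x₀≡b : x 0 ≡ b p
      x₀≡b = trans x₀≡a (a-skip (sym eq))
      step : ReflStep (conjugateBy pre i) (a p) (x 0)
      step = subst (ReflStep (conjugateBy pre i) (a p)) (sym x₀≡b)
               ( (λ k → trans (conjugateBy≈ i sp letter k) (prefix-conjugate-S p k))
               , a≁b p ∘ ≡[mod]⇒∼
               , a<b (positions-≤ xs pos) (sym eq))

module SkipFactorization (m : ℕ) (u : Subword) (u∈𝒮 : In𝒮 (suc (suc m)) u) where
  open Parameters m
  open Modular n
  open Chain n
  open Prefix m (bit u)
  open Positions m
  open SkipReflections m (bit u)
  open Counting m

  private
    length-u : length u ≡ N
    length-u = proj₁ u∈𝒮

    count : countSkips u ≡ 2 ℕ.* n ℕ.∸ 2
    count = proj₁ (proj₂ u∈𝒮)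

    u≈e : uProd n u ≈ e
    u≈e = proj₂ (proj₂ u∈𝒮)

    L = zip (word n) u

    length-word-n : length (word n) ≡ N
    length-word-n = trans (length-word M) (ℕP.*-comm M n)

    positions : Positions 0 L
    positions = positions-zip (word n) u (residues-word M 0) (trans length-word-n (sym length-u)) length-word-n

    bits : Bits (bit u) 0 L
    bits = bits-zip 0 (word n) u (λ _ → refl)

    spells₀ : Spells 0 []
    spells₀ = spells (λ _ → refl) (λ _ → refl)

    prefix-N≈id : ∀ k → prefix N k ≡ k
    prefix-N≈id k = trans (sym (prefix-subwordProd L positions bits k)) (u≈e k)

    2n∸2≡2M : 2 ℕ.* n ℕ.∸ 2 ≡ 2 ℕ.* M
    2n∸2≡2M = trans (cong (ℕ._∸ 2) (ℕP.*-suc 2 M)) (ℕP.m+n∸m≡n 2 (2 ℕ.* M))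

    trajectory : Trajectory (bit u) a b z
    trajectory = record
      { b≡z+n     = b≡z+n
      ; z-take    = z-take
      ; a-take    = a-take
      ; z-skip    = z-skip
      ; a-skip    = a-skip
      ; z-initial = z-initial
      ; a-initial = refl
      ; z-final   = λ N≤P P<N+M → trans (sym (z-stable N≤P P<N+M)) (prefix-N≈id _)
      ; a-final   = prefix-N≈id (+ N)
      ; b≢a+n     = λ p b≡a+n → a≁b p (∼-sym (by 1ℤ (trans b≡a+n (cong (_+_ (a p)) (sym (ℤP.*-identityˡ (+ n)))))))
      ; skips     = trans (subst (λ l → sumℤ l (isSkip ∘ bit u) ≡ + countSkips u) length-u (sumℤ-isSkip u))
                          (cong +_ (trans count 2n∸2≡2M))
      }

  skipRefls-treeLike : TreeLike n λ⟨ n ⟩ (skipRefls n u)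
  skipRefls-treeLike = length-r , prod-r , x , x , chain , λ k _ _ → ∼⇒≡[mod] (∼-refl (x k))
    where
    r = skipRefls n u
    x : ℕ → ℤ
    x = proj₁ (skip-chain (a<b trajectory) L positions bits spells₀)
    chain : IsChain x r
    chain = proj₂ (proj₂ (skip-chain (a<b trajectory) L positions bits spells₀))
    length-r : length r ≡ 2 ℕ.* n ℕ.∸ 2
    length-r = trans (length-skipReflsFrom n [] (word n) u (trans length-word-n (sym length-u))) count
    prod-r : prod r ≈ λ⟨ n ⟩
    prod-r k = begin
      prod r k                     ≡⟨ cong (prod r) (u≈e k) ⟨
      prod r (uProd n u k)         ≡⟨ skipReflsFrom-prod L positions bits spells₀ k ⟩
      wordProd L k                 ≡⟨ FullWord.wordProd≈λ m L positions k ⟩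
      λ⟨ n ⟩ k                     ∎
      where open ≡-Reasoning

lemma5p14 : (n : ℕ) → 2 ≤ n → (u : Subword) → In𝒮 n u → TreeLike n λ⟨ n ⟩ (skipRefls n u)
lemma5p14 (suc (suc m)) _ u u∈𝒮 = SkipFactorization.skipRefls-treeLike m u u∈𝒮
lemma5p14 (suc zero)    (s≤s ()) _ _
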